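{- For every $n\ge1$, \[\sum_{T\in\mathcal{O}(n)}\prod_{v\in T}\left(\frac{(\mathrm{outdeg}(v)+2)(\mathrm{outdeg}(v)+1)}{2h_v(2h_v-1)}\right)=\frac{(2n-3)!!}{n!}.\]
   Context: $\mathcal{O}(n)$ is the set of ordered (planted plane) rooted trees with $n$ nodes; $\mathrm{outdeg}(v)$ is the number of children of $v$; the hook-length $h_v$ is the number of descendants of $v$ including $v$ itself. $(2n-3)!!=\prod_{i=1}^{n-1}(2i-1)$, equal to $1$ for $n=1$. -}

module Defs where

open import Data.Nat using (ℕ; zero; suc; _+_; _*_; _∸_; NonZero)
open import Data.Nat.Properties using (m*n≢0)
open import Data.Integer using (+_)
open import Data.Rational using (ℚ; _/_; 1ℚ)
import Data.Rational as Q
open import Data.List using (List; []; _∷_; length)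

-- Ordered (planted plane) rooted trees: a node with an ordered list of subtrees.
data Tree : Set where
  node : List Tree → Tree

mutual
  -- number of nodes of a tree (= hook length of its root)
  size : Tree → ℕ
  size (node ts) = suc (sizeF ts)

  sizeF : List Tree → ℕ
  sizeF [] = 0
  sizeF (t ∷ ts) = size t + sizeF ts

-- (outdeg(v)+2)(outdeg(v)+1) / (2 h_v (2 h_v - 1)), with h_v = suc k ≥ 1,
-- so 2 h_v - 1 = suc (2 * k)
factor : (d h : ℕ) → ℚ
factor d zero = 1ℚ   -- never used: hook lengths are ≥ 1
factor d (suc k) =
  _/_ (+ ((d + 2) * (d + 1))) ((2 * suc k) * (suc (2 * k)))
    {{m*n≢0 (2 * suc k) (suc (2 * k))}}

mutual
  weight : Tree → ℚ
  weight (node ts) = factor (length ts) (suc (sizeF ts)) Q.* weightF ts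

  weightF : List Tree → ℚ
  weightF [] = 1ℚ
  weightF (t ∷ ts) = weight t Q.* weightF ts

-- oddProd m = ∏_{i=1}^{m} (2i-1); so (2n-3)!! = oddProd (n ∸ 1)
oddProd : ℕ → ℕ
oddProd zero = 1
oddProd (suc m) = oddProd m * (2 * m + 1)

doubleFact2n-3 : ℕ → ℕ
doubleFact2n-3 n = oddProd (n ∸ 1)

sumℚ : List ℚ → ℚ
sumℚ [] = Q.0ℚ
sumℚ (x ∷ xs) = x Q.+ sumℚ xs

{-# OPTIONS --safe #-}
-- Let τ k be the total weight of the trees with k + 1 nodes, and give a forest the product of
-- the weights of its trees.  A tree is a root above a forest, and a nonempty forest is a first
-- tree followed by a forest.  The factor of the root depends only on its outdegree d and on the
-- size, and it is a multiple of (d + 2)(d + 1); so the sums over the forests with m nodes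
-- weighted by 1, d + 1 and (d + 2)(d + 1) satisfy a closed system of convolution equations with
-- τ, which determines all four sequences by induction on m.  The system is solved by the
-- coefficients of (1 - 2x)^(-1/2), (1 - 2x)^(-1), 2 (1 - 2x)^(-3/2) and (1 - √(1 - 2x)) / x,
-- and the last ones are (2k - 1)!! / (k + 1)!.  No power series are formed: the series
-- (1 - 2x)^(-β/2) is represented by the recurrence (n + 1) a (n + 1) = (2n + β) a n of its
-- coefficients, and the Leibniz rule for n · a n shows that convolution adds the exponents β.
module Submission where

open import Defs
open import Data.Integer using (+_)
import Data.Integer as ℤ using (_*_; _+_)
open import Data.Integer.Properties using (pos-*; pos-+)
open import Data.List
  using (List; []; _∷_; [_]; _++_; map; length; concat; applyUpTo; cartesianProductWith)
open import Data.List.Membership.Propositional using (_∈_)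
open import Data.List.Membership.Propositional.Properties
  using ( ∈-map⁺; ∈-map⁻; ∈-concat⁺′; ∈-concat⁻′; ∈-applyUpTo⁺; ∈-applyUpTo⁻
        ; ∈-cartesianProductWith⁺; ∈-cartesianProductWith⁻)
open import Data.List.Membership.Propositional.Properties.WithK using (unique∧set⇒bag)
open import Data.List.Properties using (map-++; map-∘; map-cong; map-cong-local; ++-identityʳ)
open import Data.List.Relation.Binary.BagAndSetEquality using (∼bag⇒↭)
open import Data.List.Relation.Binary.Disjoint.Propositional using (Disjoint)
open import Data.List.Relation.Binary.Permutation.Propositional using (_↭_)
import Data.List.Relation.Binary.Permutation.Propositional as ↭
import Data.List.Relation.Binary.Permutation.Propositional.Properties as ↭ₚ
open import Data.List.Relation.Unary.All using ([]; tabulate)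
import Data.List.Relation.Unary.All.Properties as All
open import Data.List.Relation.Unary.AllPairs using ([]; _∷_)
import Data.List.Relation.Unary.AllPairs.Properties as AllPairs
open import Data.List.Relation.Unary.Any using (here; there)
open import Data.List.Relation.Unary.Unique.Propositional using (Unique)
import Data.List.Relation.Unary.Unique.Propositional.Properties as Unique
open import Data.Nat as ℕ using (ℕ; zero; suc; _∸_; _≤_; _≥_; _!; z≤n; s≤s; NonZero)
open import Data.Nat.Properties
  using ( _!≢0; m*n≢0; *-identityˡ; *-identityʳ; *-assoc; +-comm; suc-injective; <⇒≢
        ; ≤-refl; ≤-reflexive; ≤-trans; ≤-pred; m≤m+n; m≤n+m; m∸n≤m; m+n∸m≡n; m+[n∸m]≡n)
open import Data.Nat.Tactic.RingSolver using (solve-∀)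
open import Data.Product using (_×_; _,_)
open import Data.Rational using (ℚ; _/_; 0ℚ; 1ℚ; _+_; _*_; -_; toℚᵘ)
import Data.Rational.Properties as ℚ
open import Data.Rational.Solver using (module +-*-Solver)
open +-*-Solver using (solve; _:=_; _:+_; _:*_; :-_; con)
open import Data.Rational.Unnormalised using (mkℚᵘ; *≡*) renaming (_≃_ to _≃ᵘ_)
import Data.Rational.Unnormalised.Properties as ℚᵘ
open import Function using (_∘_)
open import Function.Bundles using (_⇔_; mk⇔)
import Function.Properties.Equivalence as ⇔
open import Relation.Binary.PropositionalEquality
  using (_≡_; _≢_; _≗_; refl; sym; trans; cong; cong₂; subst; module ≡-Reasoning)
open ≡-Reasoning

fromℕ : ℕ → ℚ
fromℕ n = + n / 1

1/suc : ℕ → ℚ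
1/suc n = + 1 / suc n

toℚᵘ-/ : ∀ a b → toℚᵘ (+ a / suc b) ≃ᵘ mkℚᵘ (+ a) b
toℚᵘ-/ a b = ℚ.toℚᵘ-fromℚᵘ (mkℚᵘ (+ a) b)

/-cross : ∀ a b c d .{{_ : NonZero b}} .{{_ : NonZero d}} →
          a ℕ.* d ≡ c ℕ.* b → + a / b ≡ + c / d
/-cross a (suc b) c (suc d) ad≡cb = ℚ.toℚᵘ-injective
  (ℚᵘ.≃-trans (toℚᵘ-/ a b) (ℚᵘ.≃-trans (*≡* +ad≡+cb) (ℚᵘ.≃-sym (toℚᵘ-/ c d))))
  where
  +ad≡+cb = trans (sym (pos-* a (suc d))) (trans (cong +_ ad≡cb) (pos-* c (suc b)))

/-*-/ : ∀ a b c d .{{_ : NonZero b}} .{{_ : NonZero d}} →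
        (+ a / b) * (+ c / d) ≡ _/_ (+ (a ℕ.* c)) (b ℕ.* d) {{m*n≢0 b d}}
/-*-/ a (suc b) c (suc d) = ℚ.toℚᵘ-injective
  (ℚᵘ.≃-trans (ℚ.toℚᵘ-homo-* (+ a / suc b) (+ c / suc d))
  (ℚᵘ.≃-trans (ℚᵘ.*-cong (toℚᵘ-/ a b) (toℚᵘ-/ c d))
  (ℚᵘ.≃-trans (*≡* (cong (ℤ._* (+ (suc b ℕ.* suc d))) (sym (pos-* a c))))
               (ℚᵘ.≃-sym (toℚᵘ-/ (a ℕ.* c) _)))))

/-+-/ : ∀ a b c d .{{_ : NonZero b}} .{{_ : NonZero d}} →
        (+ a / b) + (+ c / d) ≡ _/_ (+ (a ℕ.* d ℕ.+ c ℕ.* b)) (b ℕ.* d) {{m*n≢0 b d}}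
/-+-/ a (suc b) c (suc d) = ℚ.toℚᵘ-injective
  (ℚᵘ.≃-trans (ℚ.toℚᵘ-homo-+ (+ a / suc b) (+ c / suc d))
  (ℚᵘ.≃-trans (ℚᵘ.+-cong (toℚᵘ-/ a b) (toℚᵘ-/ c d))
  (ℚᵘ.≃-trans (*≡* (cong (ℤ._* (+ (suc b ℕ.* suc d))) +ad+cb))
               (ℚᵘ.≃-sym (toℚᵘ-/ (a ℕ.* suc d ℕ.+ c ℕ.* suc b) _)))))
  where
  +ad+cb = trans (cong₂ ℤ._+_ (sym (pos-* a (suc d))) (sym (pos-* c (suc b))))
                 (sym (pos-+ (a ℕ.* suc d) (c ℕ.* suc b)))

fromℕ-*-/ : ∀ a c d .{{_ : NonZero d}} → fromℕ a * (+ c / d) ≡ + (a ℕ.* c) / d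
fromℕ-*-/ a c d@(suc _) =
  trans (/-*-/ a 1 c d) (/-cross (a ℕ.* c) (1 ℕ.* d) (a ℕ.* c) d (cong ((a ℕ.* c) ℕ.*_) (sym (*-identityˡ d))))

fromℕ-+ : ∀ m n → fromℕ (m ℕ.+ n) ≡ fromℕ m + fromℕ n
fromℕ-+ m n = sym (trans (/-+-/ m 1 n 1) (cong (λ k → + k / 1) (cong₂ ℕ._+_ (*-identityʳ m) (*-identityʳ n))))

fromℕ-* : ∀ m n → fromℕ (m ℕ.* n) ≡ fromℕ m * fromℕ n
fromℕ-* m n = sym (/-*-/ m 1 n 1)

fromℕ-suc : ∀ n → fromℕ (suc n) ≡ fromℕ n + 1ℚ
fromℕ-suc n = trans (cong fromℕ (+-comm 1 n)) (fromℕ-+ n 1)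

fromℕ-2n+ : ∀ n c → fromℕ n + fromℕ n + fromℕ c ≡ fromℕ (n ℕ.+ n ℕ.+ c)
fromℕ-2n+ n c = sym (trans (fromℕ-+ (n ℕ.+ n) c) (cong (_+ fromℕ c) (fromℕ-+ n n)))

1/suc-inverse : ∀ n → 1/suc n * fromℕ (suc n) ≡ 1ℚ
1/suc-inverse n = trans (/-*-/ 1 (suc n) (suc n) 1) (/-cross (1 ℕ.* suc n) (suc n ℕ.* 1) 1 1 (*-assoc 1 (suc n) 1))

-- Convolution of coefficient sequences

sum≤ : ℕ → (ℕ → ℚ) → ℚ
sum≤ zero    F = F 0
sum≤ (suc n) F = F 0 + sum≤ n (F ∘ suc)

sum≤-cong : ∀ n {F G : ℕ → ℚ} → (∀ k → k ≤ n → F k ≡ G k) → sum≤ n F ≡ sum≤ n G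
sum≤-cong zero    F≡G = F≡G 0 z≤n
sum≤-cong (suc n) F≡G = cong₂ _+_ (F≡G 0 z≤n) (sum≤-cong n (λ k k≤n → F≡G (suc k) (s≤s k≤n)))

sum≤-+ : ∀ n (F G : ℕ → ℚ) → sum≤ n (λ k → F k + G k) ≡ sum≤ n F + sum≤ n G
sum≤-+ zero    F G = refl
sum≤-+ (suc n) F G = trans (cong (_+_ (F 0 + G 0)) (sum≤-+ n (F ∘ suc) (G ∘ suc)))
  (solve 4 (λ a b c d → (a :+ b) :+ (c :+ d) := (a :+ c) :+ (b :+ d)) refl (F 0) (G 0) _ _)

sum≤-*ˡ : ∀ n c (F : ℕ → ℚ) → sum≤ n (λ k → c * F k) ≡ c * sum≤ n F
sum≤-*ˡ zero    c F = refl
sum≤-*ˡ (suc n) c F = trans (cong (_+_ (c * F 0)) (sum≤-*ˡ n c (F ∘ suc))) (sym (ℚ.*-distribˡ-+ c (F 0) _))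

infixl 7 _⋆_

_⋆_ : (ℕ → ℚ) → (ℕ → ℚ) → ℕ → ℚ
(f ⋆ g) n = sum≤ n (λ k → f k * g (n ∸ k))

⋆-congˡ : ∀ {f f′} → f ≗ f′ → ∀ g n → (f ⋆ g) n ≡ (f′ ⋆ g) n
⋆-congˡ f≗f′ g n = sum≤-cong n (λ k _ → cong (_* g (n ∸ k)) (f≗f′ k))

⋆-distribʳ-+ : ∀ f f′ g n → ((λ k → f k + f′ k) ⋆ g) n ≡ (f ⋆ g) n + (f′ ⋆ g) n
⋆-distribʳ-+ f f′ g n = trans (sum≤-cong n (λ k _ → ℚ.*-distribʳ-+ (g (n ∸ k)) (f k) (f′ k)))
  (sum≤-+ n (λ k → f k * g (n ∸ k)) (λ k → f′ k * g (n ∸ k)))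

⋆-distribˡ-+ : ∀ f g g′ n → (f ⋆ (λ k → g k + g′ k)) n ≡ (f ⋆ g) n + (f ⋆ g′) n
⋆-distribˡ-+ f g g′ n = trans (sum≤-cong n (λ k _ → ℚ.*-distribˡ-+ (f k) (g (n ∸ k)) (g′ (n ∸ k))))
  (sum≤-+ n (λ k → f k * g (n ∸ k)) (λ k → f k * g′ (n ∸ k)))

⋆-*ˡ : ∀ c f g n → ((λ k → c * f k) ⋆ g) n ≡ c * (f ⋆ g) n
⋆-*ˡ c f g n = trans (sum≤-cong n (λ k _ → ℚ.*-assoc c (f k) (g (n ∸ k))))
  (sum≤-*ˡ n c (λ k → f k * g (n ∸ k)))

⋆-*ʳ : ∀ c f g n → (f ⋆ (λ k → c * g k)) n ≡ c * (f ⋆ g) n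
⋆-*ʳ c f g n = trans (sum≤-cong n (λ k _ → solve 3 (λ a b c → a :* (c :* b) := c :* (a :* b)) refl (f k) (g (n ∸ k)) c))
  (sum≤-*ˡ n c (λ k → f k * g (n ∸ k)))

⋆-sucʳ : ∀ f g n → (f ⋆ g) (suc n) ≡ (f ⋆ (g ∘ suc)) n + f (suc n) * g 0
⋆-sucʳ f g zero    = refl
⋆-sucʳ f g (suc n) = trans (cong (_+_ (f 0 * g (suc (suc n)))) (⋆-sucʳ (f ∘ suc) g n))
  (sym (ℚ.+-assoc (f 0 * g (suc (suc n))) _ _))

-- The Euler operator x d/dx on coefficient sequences.
θ : (ℕ → ℚ) → ℕ → ℚ
θ f n = fromℕ n * f n

θ-suc : ∀ f k → θ f (suc k) ≡ θ (f ∘ suc) k + f (suc k)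
θ-suc f k = trans (cong (_* f (suc k)) (fromℕ-suc k))
  (solve 2 (λ x y → (x :+ con 1ℚ) :* y := x :* y :+ y) refl (fromℕ k) (f (suc k)))

θ∘suc-⋆ : ∀ f g n → ((θ f ∘ suc) ⋆ g) n ≡ (θ (f ∘ suc) ⋆ g) n + ((f ∘ suc) ⋆ g) n
θ∘suc-⋆ f g n = trans (⋆-congˡ (θ-suc f) g n) (⋆-distribʳ-+ (θ (f ∘ suc)) (f ∘ suc) g n)

θ-⋆ : ∀ f g n → θ (f ⋆ g) n ≡ (θ f ⋆ g) n + (f ⋆ θ g) n
θ-⋆ f g zero = solve 2 (λ a b → con 0ℚ :* (a :* b) := con 0ℚ :* a :* b :+ a :* (con 0ℚ :* b)) refl (f 0) (g 0)
θ-⋆ f g (suc m) = begin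
  fromℕ (suc m) * (a * b + C)
    ≡⟨ cong (_* (a * b + C)) (fromℕ-suc m) ⟩
  (x + 1ℚ) * (a * b + C)
    ≡⟨ solve 4 (λ x a b C → (x :+ con 1ℚ) :* (a :* b :+ C) := a :* ((x :+ con 1ℚ) :* b) :+ C :+ x :* C) refl x a b C ⟩
  a * ((x + 1ℚ) * b) + C + x * C
    ≡⟨ cong₂ (λ y z → a * (y * b) + C + z) (sym (fromℕ-suc m)) (θ-⋆ (f ∘ suc) g m) ⟩
  a * θ g (suc m) + C + (U + V)
    ≡⟨ solve 6 (λ a b y C U V → a :* y :+ C :+ (U :+ V) := con 0ℚ :* a :* b :+ (U :+ C) :+ (a :* y :+ V))
         refl a b (θ g (suc m)) C U V ⟩
  fromℕ 0 * a * b + (U + C) + (a * θ g (suc m) + V)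
    ≡⟨ cong (λ z → fromℕ 0 * a * b + z + (a * θ g (suc m) + V)) (θ∘suc-⋆ f g m) ⟨
  (θ f ⋆ g) (suc m) + (f ⋆ θ g) (suc m)
    ∎
  where
  a = f 0
  b = g (suc m)
  x = fromℕ m
  C = ((f ∘ suc) ⋆ g) m
  U = (θ (f ∘ suc) ⋆ g) m
  V = ((f ∘ suc) ⋆ θ g) m

-- First-order recurrences and binomial series

Recurrence : (u γ f : ℕ → ℚ) → Set
Recurrence u γ f = ∀ n → u n * f (suc n) ≡ γ n * f n

recurrence-unique : ∀ {u γ f g} (v : ℕ → ℚ) → (∀ n → v n * u n ≡ 1ℚ) →
                    Recurrence u γ f → Recurrence u γ g → f 0 ≡ g 0 → f ≗ g
recurrence-unique v vu≡1 rf rg f0≡g0 zero = f0≡g0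
recurrence-unique {u} {γ} {f} {g} v vu≡1 rf rg f0≡g0 (suc n) = begin
  f (suc n)                ≡⟨ cancel f ⟨
  v n * (u n * f (suc n))  ≡⟨ cong (v n *_) (rf n) ⟩
  v n * (γ n * f n)        ≡⟨ cong (λ y → v n * (γ n * y)) (recurrence-unique {u} {γ} {f} {g} v vu≡1 rf rg f0≡g0 n) ⟩
  v n * (γ n * g n)        ≡⟨ cong (v n *_) (rg n) ⟨
  v n * (u n * g (suc n))  ≡⟨ cancel g ⟩
  g (suc n)                ∎
  where
  cancel : ∀ h → v n * (u n * h (suc n)) ≡ h (suc n)
  cancel h = trans (sym (ℚ.*-assoc (v n) (u n) _)) (trans (cong (_* h (suc n)) (vu≡1 n)) (ℚ.*-identityˡ _))

-- Satisfied exactly by the multiples of the coefficient sequence of (1 - 2x)^(-β/2).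
BinomialRec : ℚ → (ℕ → ℚ) → Set
BinomialRec β = Recurrence (fromℕ ∘ suc) (λ n → fromℕ n + fromℕ n + β)

binomialRec-unique : ∀ {β f g} → BinomialRec β f → BinomialRec β g → f 0 ≡ g 0 → f ≗ g
binomialRec-unique {β} = recurrence-unique {γ = λ n → fromℕ n + fromℕ n + β} 1/suc 1/suc-inverse

binomialRec-θ : ∀ {β f} → BinomialRec β f → ∀ k → θ f (suc k) ≡ θ f k + θ f k + β * f k
binomialRec-θ {β} {f} rec k = trans (rec k)
  (solve 3 (λ x β y → (x :+ x :+ β) :* y := x :* y :+ x :* y :+ β :* y) refl (fromℕ k) β (f k))

binomialRec-θ∘suc-⋆ : ∀ {β f} → BinomialRec β f → ∀ g n →
                      ((θ f ∘ suc) ⋆ g) n ≡ (θ f ⋆ g) n + (θ f ⋆ g) n + β * (f ⋆ g) n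
binomialRec-θ∘suc-⋆ {β} {f} rec g n = begin
  ((θ f ∘ suc) ⋆ g) n
    ≡⟨ ⋆-congˡ (binomialRec-θ rec) g n ⟩
  ((λ k → θ f k + θ f k + β * f k) ⋆ g) n
    ≡⟨ ⋆-distribʳ-+ (λ k → θ f k + θ f k) (λ k → β * f k) g n ⟩
  ((λ k → θ f k + θ f k) ⋆ g) n + ((λ k → β * f k) ⋆ g) n
    ≡⟨ cong₂ _+_ (⋆-distribʳ-+ (θ f) (θ f) g n) (⋆-*ˡ β f g n) ⟩
  (θ f ⋆ g) n + (θ f ⋆ g) n + β * (f ⋆ g) n
    ∎

⋆-binomialRec-θ∘suc : ∀ {β g} → BinomialRec β g → ∀ f n →
                      (f ⋆ (θ g ∘ suc)) n ≡ (f ⋆ θ g) n + (f ⋆ θ g) n + β * (f ⋆ g) n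
⋆-binomialRec-θ∘suc {β} {g} rec f n = begin
  (f ⋆ (θ g ∘ suc)) n
    ≡⟨ sum≤-cong n (λ k _ → cong (f k *_) (binomialRec-θ rec (n ∸ k))) ⟩
  (f ⋆ (λ k → θ g k + θ g k + β * g k)) n
    ≡⟨ ⋆-distribˡ-+ f (λ k → θ g k + θ g k) (λ k → β * g k) n ⟩
  (f ⋆ (λ k → θ g k + θ g k)) n + (f ⋆ (λ k → β * g k)) n
    ≡⟨ cong₂ _+_ (⋆-distribˡ-+ f (θ g) (θ g) n) (⋆-*ʳ β f g n) ⟩
  (f ⋆ θ g) n + (f ⋆ θ g) n + β * (f ⋆ g) n
    ∎

binomialRec-⋆ : ∀ {β₁ β₂ f g} → BinomialRec β₁ f → BinomialRec β₂ g → BinomialRec (β₁ + β₂) (f ⋆ g)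
binomialRec-⋆ {β₁} {β₂} {f} {g} rf rg n = begin
  θ (f ⋆ g) (suc n)
    ≡⟨ θ-⋆ f g (suc n) ⟩
  θ f 0 * g (suc n) + ((θ f ∘ suc) ⋆ g) n + (f ⋆ θ g) (suc n)
    ≡⟨ cong₂ (λ y z → θ f 0 * g (suc n) + y + z) (binomialRec-θ∘suc-⋆ rf g n) (⋆-sucʳ f (θ g) n) ⟩
  θ f 0 * g (suc n) + (U + U + β₁ * C) + ((f ⋆ (θ g ∘ suc)) n + f (suc n) * θ g 0)
    ≡⟨ cong (λ z → θ f 0 * g (suc n) + (U + U + β₁ * C) + (z + f (suc n) * θ g 0)) (⋆-binomialRec-θ∘suc rg f n) ⟩
  θ f 0 * g (suc n) + (U + U + β₁ * C) + ((V + V + β₂ * C) + f (suc n) * θ g 0)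
    ≡⟨ solve 9 (λ a b b′ c U V C β₁ β₂ →
           con 0ℚ :* a :* b′ :+ (U :+ U :+ β₁ :* C) :+ ((V :+ V :+ β₂ :* C) :+ c :* (con 0ℚ :* b))
           := (U :+ V) :+ (U :+ V) :+ (β₁ :+ β₂) :* C)
         refl (f 0) (g 0) (g (suc n)) (f (suc n)) U V C β₁ β₂ ⟩
  (U + V) + (U + V) + (β₁ + β₂) * C
    ≡⟨ cong (λ z → z + z + (β₁ + β₂) * C) (θ-⋆ f g n) ⟨
  θ (f ⋆ g) n + θ (f ⋆ g) n + (β₁ + β₂) * C
    ≡⟨ solve 3 (λ x C β → x :* C :+ x :* C :+ β :* C := (x :+ x :+ β) :* C) refl (fromℕ n) C (β₁ + β₂) ⟩
  (fromℕ n + fromℕ n + (β₁ + β₂)) * C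
    ∎
  where
  C = (f ⋆ g) n
  U = (θ f ⋆ g) n
  V = (f ⋆ θ g) n

binomialRec-*ˡ : ∀ {β f} c → BinomialRec β f → BinomialRec β (λ n → c * f n)
binomialRec-*ˡ {β} {f} c rec n = begin
  fromℕ (suc n) * (c * f (suc n))  ≡⟨ solve 3 (λ u c y → u :* (c :* y) := c :* (u :* y)) refl (fromℕ (suc n)) c (f (suc n)) ⟩
  c * (fromℕ (suc n) * f (suc n))  ≡⟨ cong (c *_) (rec n) ⟩
  c * (γ * f n)                    ≡⟨ solve 3 (λ γ c y → c :* (γ :* y) := γ :* (c :* y)) refl γ c (f n) ⟩
  γ * (c * f n)                    ∎
  where
  γ = fromℕ n + fromℕ n + β

binomialSeq : ℚ → ℚ → ℕ → ℚ
binomialSeq β c zero    = c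
binomialSeq β c (suc n) = (fromℕ n + fromℕ n + β) * binomialSeq β c n * 1/suc n

binomialSeq-rec : ∀ β c → BinomialRec β (binomialSeq β c)
binomialSeq-rec β c n = begin
  fromℕ (suc n) * (X * 1/suc n)  ≡⟨ solve 3 (λ u X v → u :* (X :* v) := v :* u :* X) refl (fromℕ (suc n)) X (1/suc n) ⟩
  1/suc n * fromℕ (suc n) * X    ≡⟨ cong (_* X) (1/suc-inverse n) ⟩
  1ℚ * X                         ≡⟨ ℚ.*-identityˡ X ⟩
  X                              ∎
  where
  X = (fromℕ n + fromℕ n + β) * binomialSeq β c n

binomialSeq-0-suc : ∀ c n → binomialSeq 0ℚ c (suc n) ≡ 0ℚ
binomialSeq-0-suc c zero    = solve 1 (λ c → con 0ℚ :* c :* con 1ℚ := con 0ℚ) refl c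
binomialSeq-0-suc c (suc n) = begin
  γ * binomialSeq 0ℚ c (suc n) * 1/suc (suc n)  ≡⟨ cong (λ y → γ * y * 1/suc (suc n)) (binomialSeq-0-suc c n) ⟩
  γ * 0ℚ * 1/suc (suc n)                        ≡⟨ solve 2 (λ a b → a :* con 0ℚ :* b := con 0ℚ) refl γ (1/suc (suc n)) ⟩
  0ℚ                                            ∎
  where
  γ = fromℕ (suc n) + fromℕ (suc n) + 0ℚ

-- R, S, P, Q and τ are the coefficients of √(1 - 2x), (1 - 2x)^(-1/2), (1 - 2x)^(-1),
-- 2 (1 - 2x)^(-3/2) and (1 - √(1 - 2x)) / x.
R S P Q τ : ℕ → ℚ
R = binomialSeq (- 1ℚ) 1ℚ
S = binomialSeq 1ℚ 1ℚ
P = binomialSeq (fromℕ 2) 1ℚ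
Q = binomialSeq (fromℕ 3) (fromℕ 2)
τ k = - R (suc k)

R⋆S-suc : ∀ n → (R ⋆ S) (suc n) ≡ 0ℚ
R⋆S-suc n = trans
  (binomialRec-unique (binomialRec-⋆ (binomialSeq-rec _ _) (binomialSeq-rec _ _)) (binomialSeq-rec 0ℚ 1ℚ) refl (suc n))
  (binomialSeq-0-suc 1ℚ n)

R⋆P≗S : R ⋆ P ≗ S
R⋆P≗S = binomialRec-unique (binomialRec-⋆ (binomialSeq-rec _ _) (binomialSeq-rec _ _)) (binomialSeq-rec _ _) refl

R⋆Q≗2P : R ⋆ Q ≗ (λ n → fromℕ 2 * P n)
R⋆Q≗2P = binomialRec-unique (binomialRec-⋆ (binomialSeq-rec _ _) (binomialSeq-rec _ _))
  (binomialRec-*ˡ (fromℕ 2) (binomialSeq-rec _ _)) refl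

R⋆-suc : ∀ X n → X (suc n) ≡ (R ⋆ X) (suc n) + (τ ⋆ X) n
R⋆-suc X n = begin
  X (suc n)                        ≡⟨ solve 2 (λ x y → x := con 1ℚ :* x :+ y :+ con (- 1ℚ) :* y) refl (X (suc n)) Y ⟩
  1ℚ * X (suc n) + Y + - 1ℚ * Y    ≡⟨ cong (_+_ (1ℚ * X (suc n) + Y)) τ⋆X ⟨
  (R ⋆ X) (suc n) + (τ ⋆ X) n      ∎
  where
  Y = ((R ∘ suc) ⋆ X) n
  τ⋆X : (τ ⋆ X) n ≡ - 1ℚ * Y
  τ⋆X = trans (⋆-congˡ (λ k → solve 1 (λ r → :- r := con (- 1ℚ) :* r) refl (R (suc k))) X n)
              (⋆-*ˡ (- 1ℚ) (R ∘ suc) X n)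

S-suc : ∀ n → S (suc n) ≡ (τ ⋆ S) n
S-suc n = begin
  S (suc n)                    ≡⟨ R⋆-suc S n ⟩
  (R ⋆ S) (suc n) + (τ ⋆ S) n  ≡⟨ cong (_+ (τ ⋆ S) n) (R⋆S-suc n) ⟩
  0ℚ + (τ ⋆ S) n               ≡⟨ ℚ.+-identityˡ _ ⟩
  (τ ⋆ S) n                    ∎

P-suc : ∀ n → P (suc n) ≡ (τ ⋆ (λ j → P j + S j)) n
P-suc n = begin
  P (suc n)                    ≡⟨ R⋆-suc P n ⟩
  (R ⋆ P) (suc n) + (τ ⋆ P) n  ≡⟨ cong (_+ (τ ⋆ P) n) (trans (R⋆P≗S (suc n)) (S-suc n)) ⟩
  (τ ⋆ S) n + (τ ⋆ P) n        ≡⟨ ℚ.+-comm ((τ ⋆ S) n) ((τ ⋆ P) n) ⟩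
  (τ ⋆ P) n + (τ ⋆ S) n        ≡⟨ ⋆-distribˡ-+ τ P S n ⟨
  (τ ⋆ (λ j → P j + S j)) n    ∎

Q-suc : ∀ n → Q (suc n) ≡ (τ ⋆ (λ j → Q j + fromℕ 2 * (P j + S j))) n
Q-suc n = begin
  Q (suc n)
    ≡⟨ R⋆-suc Q n ⟩
  (R ⋆ Q) (suc n) + (τ ⋆ Q) n
    ≡⟨ cong (_+ (τ ⋆ Q) n) (trans (R⋆Q≗2P (suc n)) (cong (fromℕ 2 *_) (P-suc n))) ⟩
  fromℕ 2 * (τ ⋆ P⁺) n + (τ ⋆ Q) n
    ≡⟨ ℚ.+-comm (fromℕ 2 * (τ ⋆ P⁺) n) ((τ ⋆ Q) n) ⟩
  (τ ⋆ Q) n + fromℕ 2 * (τ ⋆ P⁺) n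
    ≡⟨ cong (_+_ ((τ ⋆ Q) n)) (⋆-*ʳ (fromℕ 2) τ P⁺ n) ⟨
  (τ ⋆ Q) n + (τ ⋆ (λ j → fromℕ 2 * P⁺ j)) n
    ≡⟨ ⋆-distribˡ-+ τ Q (λ j → fromℕ 2 * P⁺ j) n ⟨
  (τ ⋆ (λ j → Q j + fromℕ 2 * P⁺ j)) n
    ∎
  where
  P⁺ : ℕ → ℚ
  P⁺ j = P j + S j

TreeRec : (ℕ → ℚ) → Set
TreeRec = Recurrence (fromℕ ∘ suc ∘ suc) (λ n → fromℕ n + fromℕ n + 1ℚ)

treeRec-unique : ∀ {f g} → TreeRec f → TreeRec g → f 0 ≡ g 0 → f ≗ g
treeRec-unique = recurrence-unique {γ = λ n → fromℕ n + fromℕ n + 1ℚ} (1/suc ∘ suc) (1/suc-inverse ∘ suc)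

τ-rec : TreeRec τ
τ-rec n = begin
  fromℕ (suc (suc n)) * - R (suc (suc n))
    ≡⟨ solve 2 (λ u r → u :* (:- r) := :- (u :* r)) refl (fromℕ (suc (suc n))) (R (suc (suc n))) ⟩
  - (fromℕ (suc (suc n)) * R (suc (suc n)))
    ≡⟨ cong -_ (binomialSeq-rec _ _ (suc n)) ⟩
  - ((fromℕ (suc n) + fromℕ (suc n) + - 1ℚ) * R (suc n))
    ≡⟨ cong (λ y → - ((y + y + - 1ℚ) * R (suc n))) (fromℕ-suc n) ⟩
  - ((fromℕ n + 1ℚ + (fromℕ n + 1ℚ) + - 1ℚ) * R (suc n))
    ≡⟨ solve 2 (λ y r → :- ((y :+ con 1ℚ :+ (y :+ con 1ℚ) :+ con (- 1ℚ)) :* r) := (y :+ y :+ con 1ℚ) :* (:- r))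
         refl (fromℕ n) (R (suc n)) ⟩
  (fromℕ n + fromℕ n + 1ℚ) * τ n
    ∎

hookWeight : ℕ → ℚ
hookWeight k = + 1 / ((2 ℕ.* suc k) ℕ.* suc (2 ℕ.* k))

hookWeight-ratio : ∀ n → fromℕ (suc (suc n)) * hookWeight (suc n) * (fromℕ n + fromℕ n + fromℕ 3) * 1/suc n
                         ≡ (fromℕ n + fromℕ n + 1ℚ) * hookWeight n
hookWeight-ratio n = begin
  fromℕ (suc (suc n)) * hookWeight (suc n) * (fromℕ n + fromℕ n + fromℕ 3) * 1/suc n
    ≡⟨ cong (λ y → fromℕ (suc (suc n)) * hookWeight (suc n) * y * 1/suc n) (fromℕ-2n+ n 3) ⟩
  fromℕ (suc (suc n)) * hookWeight (suc n) * fromℕ (2n+ 3) * 1/suc n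
    ≡⟨ solve 4 (λ a w b v → a :* w :* b :* v := a :* (b :* (v :* w)))
         refl (fromℕ (suc (suc n))) (hookWeight (suc n)) (fromℕ (2n+ 3)) (1/suc n) ⟩
  fromℕ (suc (suc n)) * (fromℕ (2n+ 3) * (1/suc n * hookWeight (suc n)))
    ≡⟨ cong (λ y → fromℕ (suc (suc n)) * (fromℕ (2n+ 3) * y)) (/-*-/ 1 (suc n) 1 D₁) ⟩
  fromℕ (suc (suc n)) * (fromℕ (2n+ 3) * (+ 1 / (suc n ℕ.* D₁)))
    ≡⟨ cong (fromℕ (suc (suc n)) *_) (fromℕ-*-/ (2n+ 3) 1 (suc n ℕ.* D₁)) ⟩
  fromℕ (suc (suc n)) * (+ (2n+ 3 ℕ.* 1) / (suc n ℕ.* D₁))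
    ≡⟨ fromℕ-*-/ (suc (suc n)) (2n+ 3 ℕ.* 1) (suc n ℕ.* D₁) ⟩
  + (suc (suc n) ℕ.* (2n+ 3 ℕ.* 1)) / (suc n ℕ.* D₁)
    ≡⟨ /-cross (suc (suc n) ℕ.* (2n+ 3 ℕ.* 1)) (suc n ℕ.* D₁) (2n+ 1 ℕ.* 1) D₀ (cross n) ⟩
  + (2n+ 1 ℕ.* 1) / D₀
    ≡⟨ fromℕ-*-/ (2n+ 1) 1 D₀ ⟨
  fromℕ (2n+ 1) * hookWeight n
    ≡⟨ cong (_* hookWeight n) (fromℕ-2n+ n 1) ⟨
  (fromℕ n + fromℕ n + 1ℚ) * hookWeight n
    ∎
  where
  2n+ : ℕ → ℕ
  2n+ c = n ℕ.+ n ℕ.+ c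
  D₀ = (2 ℕ.* suc n) ℕ.* suc (2 ℕ.* n)
  D₁ = (2 ℕ.* suc (suc n)) ℕ.* suc (2 ℕ.* suc n)
  cross : ∀ n → suc (suc n) ℕ.* ((n ℕ.+ n ℕ.+ 3) ℕ.* 1) ℕ.* ((2 ℕ.* suc n) ℕ.* suc (2 ℕ.* n))
              ≡ (n ℕ.+ n ℕ.+ 1) ℕ.* 1 ℕ.* (suc n ℕ.* ((2 ℕ.* suc (suc n)) ℕ.* suc (2 ℕ.* suc n)))
  cross = solve-∀

hookWeight*Q-rec : TreeRec (λ k → hookWeight k * Q k)
hookWeight*Q-rec n = begin
  fromℕ (suc (suc n)) * (hookWeight (suc n) * (γ * Q n * 1/suc n))
    ≡⟨ solve 5 (λ a w b q v → a :* (w :* (b :* q :* v)) := a :* w :* b :* v :* q)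
         refl (fromℕ (suc (suc n))) (hookWeight (suc n)) γ (Q n) (1/suc n) ⟩
  fromℕ (suc (suc n)) * hookWeight (suc n) * γ * 1/suc n * Q n
    ≡⟨ cong (_* Q n) (hookWeight-ratio n) ⟩
  (fromℕ n + fromℕ n + 1ℚ) * hookWeight n * Q n
    ≡⟨ ℚ.*-assoc (fromℕ n + fromℕ n + 1ℚ) (hookWeight n) (Q n) ⟩
  (fromℕ n + fromℕ n + 1ℚ) * (hookWeight n * Q n)
    ∎
  where
  γ = fromℕ n + fromℕ n + fromℕ 3

oddProd/! : ℕ → ℚ
oddProd/! k = _/_ (+ oddProd k) (suc k !) {{suc k !≢0}}

oddProd/!-rec : TreeRec oddProd/!
oddProd/!-rec n = begin
  fromℕ (suc (suc n)) * oddProd/! (suc n)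
    ≡⟨ fromℕ-*-/ (suc (suc n)) (oddProd (suc n)) (suc (suc n) !) {{suc (suc n) !≢0}} ⟩
  over! (suc (suc n) ℕ.* oddProd (suc n)) (suc n)
    ≡⟨ /-cross (suc (suc n) ℕ.* oddProd (suc n)) (suc (suc n) !) ((n ℕ.+ n ℕ.+ 1) ℕ.* oddProd n) (suc n !)
         {{suc (suc n) !≢0}} {{suc n !≢0}} (cross n (oddProd n) (suc n !)) ⟩
  over! ((n ℕ.+ n ℕ.+ 1) ℕ.* oddProd n) n
    ≡⟨ fromℕ-*-/ (n ℕ.+ n ℕ.+ 1) (oddProd n) (suc n !) {{suc n !≢0}} ⟨
  fromℕ (n ℕ.+ n ℕ.+ 1) * oddProd/! n
    ≡⟨ cong (_* oddProd/! n) (fromℕ-2n+ n 1) ⟨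
  (fromℕ n + fromℕ n + 1ℚ) * oddProd/! n
    ∎
  where
  over! : ℕ → ℕ → ℚ
  over! a k = _/_ (+ a) (suc k !) {{suc k !≢0}}
  cross : ∀ n o f → suc (suc n) ℕ.* (o ℕ.* (2 ℕ.* n ℕ.+ 1)) ℕ.* f ≡ (n ℕ.+ n ℕ.+ 1) ℕ.* o ℕ.* (suc (suc n) ℕ.* f)
  cross = solve-∀

hookWeight*Q≗τ : (λ k → hookWeight k * Q k) ≗ τ
hookWeight*Q≗τ = treeRec-unique hookWeight*Q-rec τ-rec refl

τ≗oddProd/! : τ ≗ oddProd/!
τ≗oddProd/! = treeRec-unique τ-rec oddProd/!-rec refl

sumℚ-++ : ∀ xs ys → sumℚ (xs ++ ys) ≡ sumℚ xs + sumℚ ys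
sumℚ-++ []       ys = sym (ℚ.+-identityˡ _)
sumℚ-++ (x ∷ xs) ys = trans (cong (_+_ x) (sumℚ-++ xs ys)) (sym (ℚ.+-assoc x _ _))

sumℚ-↭ : ∀ {xs ys} → xs ↭ ys → sumℚ xs ≡ sumℚ ys
sumℚ-↭ ↭.refl           = refl
sumℚ-↭ (↭.prep x p)     = cong (_+_ x) (sumℚ-↭ p)
sumℚ-↭ (↭.swap x y p)   = trans (cong (λ z → x + (y + z)) (sumℚ-↭ p))
  (solve 3 (λ a b c → a :+ (b :+ c) := b :+ (a :+ c)) refl x y _)
sumℚ-↭ (↭.trans p q)    = trans (sumℚ-↭ p) (sumℚ-↭ q)

sumℚ-map-+ : ∀ {A : Set} (F G : A → ℚ) xs → sumℚ (map (λ x → F x + G x) xs) ≡ sumℚ (map F xs) + sumℚ (map G xs)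
sumℚ-map-+ F G []       = refl
sumℚ-map-+ F G (x ∷ xs) = trans (cong (_+_ (F x + G x)) (sumℚ-map-+ F G xs))
  (solve 4 (λ a b c d → a :+ b :+ (c :+ d) := a :+ c :+ (b :+ d)) refl (F x) (G x) _ _)

sumℚ-map-*ˡ : ∀ {A : Set} c (F : A → ℚ) xs → sumℚ (map (λ x → c * F x) xs) ≡ c * sumℚ (map F xs)
sumℚ-map-*ˡ c F []       = sym (ℚ.*-zeroʳ c)
sumℚ-map-*ˡ c F (x ∷ xs) = trans (cong (_+_ (c * F x)) (sumℚ-map-*ˡ c F xs)) (sym (ℚ.*-distribˡ-+ c (F x) _))

sumℚ-concat-applyUpTo : ∀ {A : Set} (F : A → ℚ) (G : ℕ → List A) m →
                        sumℚ (map F (concat (applyUpTo G (suc m)))) ≡ sum≤ m (λ k → sumℚ (map F (G k)))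
sumℚ-concat-applyUpTo F G zero    = cong (sumℚ ∘ map F) (++-identityʳ (G 0))
sumℚ-concat-applyUpTo F G (suc m) = begin
  sumℚ (map F (G 0 ++ rest))              ≡⟨ cong sumℚ (map-++ F (G 0) rest) ⟩
  sumℚ (map F (G 0) ++ map F rest)        ≡⟨ sumℚ-++ (map F (G 0)) (map F rest) ⟩
  sumℚ (map F (G 0)) + sumℚ (map F rest)  ≡⟨ cong (_+_ (sumℚ (map F (G 0)))) (sumℚ-concat-applyUpTo F (G ∘ suc) m) ⟩
  sum≤ (suc m) (λ k → sumℚ (map F (G k))) ∎
  where
  rest = concat (applyUpTo (G ∘ suc) (suc m))

sumℚ-cartesianProductWith : ∀ {A B C : Set} (_∙_ : A → B → C) (F : C → ℚ) (u : A → ℚ) (v : B → ℚ) →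
                            (∀ x y → F (x ∙ y) ≡ u x * v y) → ∀ xs ys →
                            sumℚ (map F (cartesianProductWith _∙_ xs ys)) ≡ sumℚ (map u xs) * sumℚ (map v ys)
sumℚ-cartesianProductWith _∙_ F u v F≡uv []       ys = sym (ℚ.*-zeroˡ (sumℚ (map v ys)))
sumℚ-cartesianProductWith _∙_ F u v F≡uv (x ∷ xs) ys = begin
  sumℚ (map F (map (x ∙_) ys ++ rest))              ≡⟨ cong sumℚ (map-++ F (map (x ∙_) ys) rest) ⟩
  sumℚ (map F (map (x ∙_) ys) ++ map F rest)        ≡⟨ sumℚ-++ (map F (map (x ∙_) ys)) (map F rest) ⟩
  sumℚ (map F (map (x ∙_) ys)) + sumℚ (map F rest)  ≡⟨ cong₂ _+_ row (sumℚ-cartesianProductWith _∙_ F u v F≡uv xs ys) ⟩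
  u x * Σv + sumℚ (map u xs) * Σv                   ≡⟨ ℚ.*-distribʳ-+ Σv (u x) (sumℚ (map u xs)) ⟨
  (u x + sumℚ (map u xs)) * Σv                      ∎
  where
  rest = cartesianProductWith _∙_ xs ys
  Σv = sumℚ (map v ys)
  row : sumℚ (map F (map (x ∙_) ys)) ≡ u x * Σv
  row = trans (cong sumℚ (trans (sym (map-∘ ys)) (map-cong (F≡uv x) ys))) (sumℚ-map-*ˡ (u x) v ys)

-- Forests by number of nodes

consNode : List Tree → List Tree → List Tree
consNode ts us = node ts ∷ us

consNode-injective : ∀ {ts ts′ us us′} → consNode ts us ≡ consNode ts′ us′ → ts ≡ ts′ × us ≡ us′
consNode-injective refl = refl , refl

-- forests fuel m lists the forests with m nodes, all of them only when m ≤ fuel;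
-- forestsWithFirst fuel m k those with m + 1 nodes whose first tree has k + 1 nodes.
mutual
  forests : ℕ → ℕ → List (List Tree)
  forests _          zero    = [ [] ]
  forests zero       (suc m) = []
  forests (suc fuel) (suc m) = concat (applyUpTo (forestsWithFirst fuel m) (suc m))

  forestsWithFirst : ℕ → ℕ → ℕ → List (List Tree)
  forestsWithFirst fuel m k = cartesianProductWith consNode (forests fuel k) (forests fuel (m ∸ k))

sizeF-∈forests : ∀ fuel m {ts} → ts ∈ forests fuel m → sizeF ts ≡ m
sizeF-∈forests _          zero    (here refl) = refl
sizeF-∈forests _          zero    (there ())
sizeF-∈forests zero       (suc m) ()
sizeF-∈forests (suc fuel) (suc m) ts∈
  with _ , ts∈us , us∈ ← ∈-concat⁻′ (applyUpTo (forestsWithFirst fuel m) (suc m)) ts∈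
  with k , k<1+m , refl ← ∈-applyUpTo⁻ (forestsWithFirst fuel m) us∈
  with vs , ws , vs∈ , ws∈ , refl ← ∈-cartesianProductWith⁻ consNode (forests fuel k) (forests fuel (m ∸ k)) ts∈us
  = cong suc (begin
    sizeF vs ℕ.+ sizeF ws  ≡⟨ cong₂ ℕ._+_ (sizeF-∈forests fuel k vs∈) (sizeF-∈forests fuel (m ∸ k) ws∈) ⟩
    k ℕ.+ (m ∸ k)          ≡⟨ m+[n∸m]≡n (≤-pred k<1+m) ⟩
    m                      ∎)

∈-forests : ∀ fuel ts → sizeF ts ≤ fuel → ts ∈ forests fuel (sizeF ts)
∈-forests _          []             _                = here refl
∈-forests (suc fuel) (node vs ∷ ws) (s≤s size≤fuel) =
  ∈-concat⁺′ (∈-cartesianProductWith⁺ consNode vs∈ ws∈)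
             (∈-applyUpTo⁺ (forestsWithFirst fuel (sizeF vs ℕ.+ sizeF ws)) (s≤s (m≤m+n (sizeF vs) (sizeF ws))))
  where
  vs∈ : vs ∈ forests fuel (sizeF vs)
  vs∈ = ∈-forests fuel vs (≤-trans (m≤m+n _ _) size≤fuel)
  ws∈ : ws ∈ forests fuel (sizeF vs ℕ.+ sizeF ws ∸ sizeF vs)
  ws∈ = subst (λ j → ws ∈ forests fuel j) (sym (m+n∸m≡n (sizeF vs) (sizeF ws)))
              (∈-forests fuel ws (≤-trans (m≤n+m _ _) size≤fuel))

forestsWithFirst-disjoint : ∀ fuel m {i j} → i ≢ j → Disjoint (forestsWithFirst fuel m i) (forestsWithFirst fuel m j)
forestsWithFirst-disjoint fuel m {i} {j} i≢j (ts∈i , ts∈j)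
  with vs , _ , vs∈ , _ , refl ← ∈-cartesianProductWith⁻ consNode (forests fuel i) _ ts∈i
  with _ , _ , vs∈′ , _ , refl ← ∈-cartesianProductWith⁻ consNode (forests fuel j) _ ts∈j
  = i≢j (trans (sym (sizeF-∈forests fuel i vs∈)) (sizeF-∈forests fuel j vs∈′))

forests-unique : ∀ fuel m → Unique (forests fuel m)
forests-unique _          zero    = [] ∷ []
forests-unique zero       (suc m) = []
forests-unique (suc fuel) (suc m) = Unique.concat⁺
  (All.applyUpTo⁺₂ (forestsWithFirst fuel m) (suc m) (λ k →
    Unique.cartesianProductWith⁺ consNode consNode-injective (forests-unique fuel k) (forests-unique fuel (m ∸ k))))
  (AllPairs.applyUpTo⁺₁ (forestsWithFirst fuel m) (suc m) (λ i<j _ → forestsWithFirst-disjoint fuel m (<⇒≢ i<j)))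

forestSum : (ℕ → ℚ) → List (List Tree) → ℚ
forestSum c = sumℚ ∘ map (λ ts → c (length ts) * weightF ts)

treeSum : List (List Tree) → ℚ
treeSum = sumℚ ∘ map (weight ∘ node)

forestSum-cong : ∀ {c c′} → c ≗ c′ → forestSum c ≗ forestSum c′
forestSum-cong c≗c′ gs = cong sumℚ (map-cong (λ ts → cong (_* weightF ts) (c≗c′ (length ts))) gs)

forestSum-+ : ∀ c c′ gs → forestSum (λ d → c d + c′ d) gs ≡ forestSum c gs + forestSum c′ gs
forestSum-+ c c′ gs = trans
  (cong sumℚ (map-cong (λ ts → ℚ.*-distribʳ-+ (weightF ts) (c (length ts)) (c′ (length ts))) gs))
  (sumℚ-map-+ (λ ts → c (length ts) * weightF ts) (λ ts → c′ (length ts) * weightF ts) gs)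

forestSum-*ˡ : ∀ a c gs → forestSum (λ d → a * c d) gs ≡ a * forestSum c gs
forestSum-*ˡ a c gs = trans (cong sumℚ (map-cong (λ ts → ℚ.*-assoc a (c (length ts)) (weightF ts)) gs))
  (sumℚ-map-*ˡ a (λ ts → c (length ts) * weightF ts) gs)

forestSum-suc : ∀ c fuel m → forestSum c (forests (suc fuel) (suc m))
                ≡ sum≤ m (λ k → treeSum (forests fuel k) * forestSum (c ∘ suc) (forests fuel (m ∸ k)))
forestSum-suc c fuel m = trans (sumℚ-concat-applyUpTo _ (forestsWithFirst fuel m) m)
  (sum≤-cong m (λ k _ → sumℚ-cartesianProductWith consNode _ (weight ∘ node) (λ us → c (suc (length us)) * weightF us)
    (λ ts us → solve 3 (λ a b x → a :* (b :* x) := b :* (a :* x)) refl (c (suc (length us))) (weight (node ts)) (weightF us))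
    (forests fuel k) (forests fuel (m ∸ k))))

c₀ c₁ c₂ : ℕ → ℚ
c₀ _ = 1ℚ
c₁ d = fromℕ (suc d)
c₂ d = fromℕ ((d ℕ.+ 2) ℕ.* (d ℕ.+ 1))

c₂-suc : ∀ d → c₂ (suc d) ≡ c₂ d + fromℕ 2 * (c₁ d + c₀ d)
c₂-suc d = begin
  fromℕ ((suc d ℕ.+ 2) ℕ.* (suc d ℕ.+ 1))
    ≡⟨ cong fromℕ (split d) ⟩
  fromℕ ((d ℕ.+ 2) ℕ.* (d ℕ.+ 1) ℕ.+ 2 ℕ.* (suc d ℕ.+ 1))
    ≡⟨ fromℕ-+ ((d ℕ.+ 2) ℕ.* (d ℕ.+ 1)) (2 ℕ.* (suc d ℕ.+ 1)) ⟩
  c₂ d + fromℕ (2 ℕ.* (suc d ℕ.+ 1))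
    ≡⟨ cong (_+_ (c₂ d)) (fromℕ-* 2 (suc d ℕ.+ 1)) ⟩
  c₂ d + fromℕ 2 * fromℕ (suc d ℕ.+ 1)
    ≡⟨ cong (λ y → c₂ d + fromℕ 2 * y) (fromℕ-+ (suc d) 1) ⟩
  c₂ d + fromℕ 2 * (c₁ d + c₀ d)
    ∎
  where
  split : ∀ d → (suc d ℕ.+ 2) ℕ.* (suc d ℕ.+ 1) ≡ (d ℕ.+ 2) ℕ.* (d ℕ.+ 1) ℕ.+ 2 ℕ.* (suc d ℕ.+ 1)
  split = solve-∀

forestSum-c₁∘suc : ∀ gs → forestSum (c₁ ∘ suc) gs ≡ forestSum c₁ gs + forestSum c₀ gs
forestSum-c₁∘suc gs = trans (forestSum-cong (fromℕ-suc ∘ suc) gs) (forestSum-+ c₁ c₀ gs)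

forestSum-c₂∘suc : ∀ gs →
                   forestSum (c₂ ∘ suc) gs ≡ forestSum c₂ gs + fromℕ 2 * (forestSum c₁ gs + forestSum c₀ gs)
forestSum-c₂∘suc gs = begin
  forestSum (c₂ ∘ suc) gs
    ≡⟨ forestSum-cong c₂-suc gs ⟩
  forestSum (λ d → c₂ d + fromℕ 2 * (c₁ d + c₀ d)) gs
    ≡⟨ forestSum-+ c₂ (λ d → fromℕ 2 * (c₁ d + c₀ d)) gs ⟩
  forestSum c₂ gs + forestSum (λ d → fromℕ 2 * (c₁ d + c₀ d)) gs
    ≡⟨ cong (_+_ (forestSum c₂ gs)) (forestSum-*ˡ (fromℕ 2) (λ d → c₁ d + c₀ d) gs) ⟩
  forestSum c₂ gs + fromℕ 2 * forestSum (λ d → c₁ d + c₀ d) gs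
    ≡⟨ cong (λ y → forestSum c₂ gs + fromℕ 2 * y) (forestSum-+ c₁ c₀ gs) ⟩
  forestSum c₂ gs + fromℕ 2 * (forestSum c₁ gs + forestSum c₀ gs)
    ∎

weight-node : ∀ ts → weight (node ts) ≡ hookWeight (sizeF ts) * (c₂ (length ts) * weightF ts)
weight-node ts = begin
  factor (length ts) (suc (sizeF ts)) * weightF ts       ≡⟨ cong (_* weightF ts) factor≡ ⟩
  c₂ (length ts) * hookWeight (sizeF ts) * weightF ts    ≡⟨ solve 3 (λ c h w → c :* h :* w := h :* (c :* w))
                                                              refl (c₂ (length ts)) (hookWeight (sizeF ts)) (weightF ts) ⟩
  hookWeight (sizeF ts) * (c₂ (length ts) * weightF ts)  ∎
  where
  a = (length ts ℕ.+ 2) ℕ.* (length ts ℕ.+ 1)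
  D = (2 ℕ.* suc (sizeF ts)) ℕ.* suc (2 ℕ.* sizeF ts)
  factor≡ : factor (length ts) (suc (sizeF ts)) ≡ c₂ (length ts) * hookWeight (sizeF ts)
  factor≡ = sym (trans (fromℕ-*-/ a 1 D) (cong (λ x → + x / D) (*-identityʳ a)))

treeSum-forests : ∀ fuel k → treeSum (forests fuel k) ≡ hookWeight k * forestSum c₂ (forests fuel k)
treeSum-forests fuel k = trans
  (cong sumℚ (map-cong-local (tabulate (λ {ts} ts∈ →
    trans (weight-node ts) (cong (λ j → hookWeight j * (c₂ (length ts) * weightF ts)) (sizeF-∈forests fuel k ts∈))))))
  (sumℚ-map-*ˡ (hookWeight k) (λ ts → c₂ (length ts) * weightF ts) (forests fuel k))

record ForestSums (gs : List (List Tree)) (j : ℕ) : Set where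
  field
    sum-c₀ : forestSum c₀ gs ≡ S j
    sum-c₁ : forestSum c₁ gs ≡ P j
    sum-c₂ : forestSum c₂ gs ≡ Q j
open ForestSums

treeSum≡τ : ∀ {fuel k} → ForestSums (forests fuel k) k → treeSum (forests fuel k) ≡ τ k
treeSum≡τ {fuel} {k} sums = begin
  treeSum (forests fuel k)                      ≡⟨ treeSum-forests fuel k ⟩
  hookWeight k * forestSum c₂ (forests fuel k)  ≡⟨ cong (hookWeight k *_) (sum-c₂ sums) ⟩
  hookWeight k * Q k                            ≡⟨ hookWeight*Q≗τ k ⟩
  τ k                                           ∎

forestSums : ∀ fuel j → j ≤ fuel → ForestSums (forests fuel j) j
forestSums _          zero    _               = record { sum-c₀ = refl ; sum-c₁ = refl ; sum-c₂ = refl }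
forestSums (suc fuel) (suc m) (s≤s m≤fuel) = record
  { sum-c₀ = trans (split c₀ S (sum-c₀ ∘ sums)) (sym (S-suc m))
  ; sum-c₁ = trans (split c₁ (λ j → P j + S j) shifted₁) (sym (P-suc m))
  ; sum-c₂ = trans (split c₂ (λ j → Q j + fromℕ 2 * (P j + S j)) shifted₂) (sym (Q-suc m))
  }
  where
  sums : ∀ {j} → j ≤ m → ForestSums (forests fuel j) j
  sums j≤m = forestSums fuel _ (≤-trans j≤m m≤fuel)

  split : ∀ c X → (∀ {j} → j ≤ m → forestSum (c ∘ suc) (forests fuel j) ≡ X j) →
          forestSum c (forests (suc fuel) (suc m)) ≡ (τ ⋆ X) m
  split c X hyp = trans (forestSum-suc c fuel m)
    (sum≤-cong m (λ k k≤m → cong₂ _*_ (treeSum≡τ (sums k≤m)) (hyp (m∸n≤m m k))))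

  shifted₁ : ∀ {j} → j ≤ m → forestSum (c₁ ∘ suc) (forests fuel j) ≡ P j + S j
  shifted₁ {j} j≤m = trans (forestSum-c₁∘suc (forests fuel j)) (cong₂ _+_ (sum-c₁ (sums j≤m)) (sum-c₀ (sums j≤m)))

  shifted₂ : ∀ {j} → j ≤ m → forestSum (c₂ ∘ suc) (forests fuel j) ≡ Q j + fromℕ 2 * (P j + S j)
  shifted₂ {j} j≤m = trans (forestSum-c₂∘suc (forests fuel j))
    (cong₂ (λ q p → q + fromℕ 2 * p) (sum-c₂ (sums j≤m)) (cong₂ _+_ (sum-c₁ (sums j≤m)) (sum-c₀ (sums j≤m))))

trees : ℕ → List Tree
trees m = map node (forests m m)

trees-unique : ∀ m → Unique (trees m)
trees-unique m = Unique.map⁺ (λ { refl → refl }) (forests-unique m m)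

∈-trees⇔ : ∀ m t → t ∈ trees m ⇔ size t ≡ suc m
∈-trees⇔ m t = mk⇔ to (from t)
  where
  to : t ∈ trees m → size t ≡ suc m
  to t∈ with ts , ts∈ , refl ← ∈-map⁻ node t∈ = cong suc (sizeF-∈forests m m ts∈)
  from : ∀ t → size t ≡ suc m → t ∈ trees m
  from (node ts) size≡ = ∈-map⁺ node
    (subst (λ j → ts ∈ forests m j) sizeF≡m (∈-forests m ts (≤-reflexive sizeF≡m)))
    where
    sizeF≡m = suc-injective size≡

enumerations-↭ : ∀ {A : Set} {φ : A → Set} {xs ys : List A} → Unique xs → Unique ys →
                 (∀ x → x ∈ xs ⇔ φ x) → (∀ x → x ∈ ys ⇔ φ x) → xs ↭ ys
enumerations-↭ xs-unique ys-unique xs⇔φ ys⇔φ =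
  ∼bag⇒↭ (unique∧set⇒bag xs-unique ys-unique (λ {x} → ⇔.trans (xs⇔φ x) (⇔.sym (ys⇔φ x))))

corollary3p4 : (n : ℕ) → n ≥ 1 → (L : List Tree) → Unique L → (∀ T → (T ∈ L) ⇔ (size T ≡ n)) →
    sumℚ (map weight L) ≡ _/_ (+ doubleFact2n-3 n) (n !) {{n !≢0}}
corollary3p4 (suc m) _ L L-unique L-enumerates = begin
  sumℚ (map weight L)          ≡⟨ sumℚ-↭ (↭ₚ.map⁺ weight L↭trees) ⟩
  sumℚ (map weight (trees m))  ≡⟨ cong sumℚ (map-∘ (forests m m)) ⟨
  treeSum (forests m m)        ≡⟨ treeSum≡τ (forestSums m m ≤-refl) ⟩
  τ m                          ≡⟨ τ≗oddProd/! m ⟩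
  oddProd/! m                  ∎
  where
  L↭trees : L ↭ trees m
  L↭trees = enumerations-↭ L-unique (trees-unique m) L-enumerates (∈-trees⇔ m)
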